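{- Let $(G,\pi)$ be a parity game, $\tau$ a strategy for Odd, $T$ an ordered tree of height $d/2$, and $H:=G_\tau\setminus\bigcup_{v\in B(G_\tau)}\delta^+(v)$. Let $\nu:V\to\bar L(T)$ be a node labeling and $vw\in E(H)$ an arc that is tight with respect to $\nu$. If $\Phi^\nu(v)<\Phi^\nu(w)$, then there exists an even cycle $C$ in $H$ such that $vw\in E(C)$ and $\pi(C)=\pi(v)$.
   Context: A parity game: finite directed graph $G=(V,E)$, every node with an outgoing arc, $V=V_0\sqcup V_1$, priorities $\pi:V\to\{1,\dots,d\}$, $d$ even. A strategy for Odd is $\tau:V_1\to V$ with $v\tau(v)\in E$; $G_\tau=(V,E_\tau)$ with $E_\tau=\{vw\in E:v\in V_0\}\cup\{v\tau(v):v\in V_1\}$. For a subgraph $K$: $\pi(K)$ is its maximum priority, $K$ is even if $\pi(K)$ is even, $\Pi(K)$ is the set of nodes of $K$ of priority $\pi(K)$, $K_p$ is the subgraph induced by nodes of priority $\le p$, $\delta^+(v)$ is the set of outgoing arcs of $v$. Base nodes $B(G_\tau)$: nodes lying in $\Pi(C)$ for some even cycle $C$ of $G_\tau$. Ordered trees: prefix-closed sets of tuples over a linearly ordered set, viewed as rooted trees, ordered lexicographically; leaves of a height-$d/2$ tree are at depth $d/2$, written $\xi=(\xi_{d-1},\xi_{d-3},\dots,\xi_1)$; $\xi|_p$ deletes components with index $<p$; $\bar L(T)=L(T)\cup\{\top\}$, $\top$ maximal, $\top|_p=\top$. For $\nu:V\to\bar L(T)$, an arc $vw$ is non-violated if ($\pi(v)$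 even and $\nu(v)|_{\pi(v)}\ge\nu(w)|_{\pi(v)}$) or ($\pi(v)$ odd and ($\nu(v)|_{\pi(v)}>\nu(w)|_{\pi(v)}$ or $\nu(v)=\nu(w)=\top$)); it is tight if $\nu(v)$ is the smallest element of $\bar L(T)$ making $vw$ non-violated when substituted for $\nu(v)$. Potentials: for each even $p\in[d]$ fix a function $\Phi_p:V\to\mathbb{Z}_{\ge0}$ such that $\Phi_p(v)=0$ iff $\pi(v)>p$; $\Phi_p(v)\ge\Phi_p(w)$ whenever $v$ can reach $w$ in $H_p$; and $\Phi_p(v)=\Phi_p(w)>0$ iff $v$ and $w$ are strongly connected in $H_p$. Then $\Phi^\nu(v):=(\Phi_d(v),\nu(v)_{d-1},\Phi_{d-2}(v),\nu(v)_{d-3},\dots,\Phi_2(v),\nu(v)_1)$ if $\nu(v)\ne\top$, and $\Phi^\nu(v):=\infty$ (larger than all tuples) otherwise; tuples are compared lexicographically componentwise. -}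

module Defs where

open import Level using (0ℓ)
open import Data.Nat using (ℕ; zero; suc; _+_; _*_; _∸_; _≤_; _<_; _⊔_; _%_; ⌊_/2⌋)
open import Data.Nat.DivMod using (_mod_)
open import Data.Fin using (Fin; toℕ)
open import Data.List using (List; []; _∷_; _++_; length; take; foldr; map; allFin)
open import Data.Vec using (Vec; toList; tabulate; lookup)
open import Data.Product using (Σ; ∃; _×_; _,_)
open import Data.Sum using (_⊎_)
open import Data.Empty using (⊥)
open import Data.Unit using (⊤)
open import Data.Maybe using (Maybe; just; nothing)
open import Relation.Nullary using (¬_)
open import Relation.Binary.PropositionalEquality using (_≡_)
open import Relation.Binary.Construct.Closure.ReflexiveTransitive using (Star)
open import Data.List.Relation.Binary.Lex.Strict using (Lex-<; Lex-≤)

IsEven : ℕ → Set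
IsEven m = m % 2 ≡ 0

IsOdd : ℕ → Set
IsOdd m = m % 2 ≡ 1

-- Players: V = V₀ ⊔ V₁ is encoded by an owner function

data Player : Set where
  even odd : Player

module _ {n : ℕ} where

  next : {k : ℕ} → Fin (suc k) → Fin (suc k)
  next {k} i = suc (toℕ i) mod (suc k)

  record Cycle (R : Fin n → Fin n → Set) : Set where
    field
      len    : ℕ
      node   : Fin (suc len) → Fin n
      simple : ∀ i j → node i ≡ node j → i ≡ j
      arcs   : ∀ i → R (node i) (node (next i))
  open Cycle public

  maxPri : {R : Fin n → Fin n → Set} → (Fin n → ℕ) → Cycle R → ℕ
  maxPri π C = foldr _⊔_ 0 (map (λ i → π (node C i)) (allFin (suc (len C))))

  ArcOn : {R : Fin n → Fin n → Set} → Cycle R → Fin n → Fin n → Set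
  ArcOn C u v = Σ (Fin (suc (len C))) λ i → node C i ≡ u × node C (next i) ≡ v

  Gτ : (E : Fin n → Fin n → Set) → (Fin n → Player) → (Fin n → Fin n) →
       Fin n → Fin n → Set
  Gτ E owner τ u w = E u w × (owner u ≡ even ⊎ (owner u ≡ odd × w ≡ τ u))

  Base : (E : Fin n → Fin n → Set) → (Fin n → Player) → (Fin n → Fin n) →
         (Fin n → ℕ) → Fin n → Set
  Base E owner τ π u =
    Σ (Cycle (Gτ E owner τ)) λ C →
      IsEven (maxPri π C) × Σ (Fin (suc (len C))) λ i → node C i ≡ u × π u ≡ maxPri π C

  Hgraph : (E : Fin n → Fin n → Set) → (Fin n → Player) → (Fin n → Fin n) →
           (Fin n → ℕ) → Fin n → Fin n → Set
  Hgraph E owner τ π u w = Gτ E owner τ u w × ¬ Base E owner τ π u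

  InSub : (Fin n → ℕ) → ℕ → Fin n → Set
  InSub π p u = π u ≤ p

  SubArc : (Fin n → Fin n → Set) → (Fin n → ℕ) → ℕ → Fin n → Fin n → Set
  SubArc K π p u w = K u w × π u ≤ p × π w ≤ p

  Reach : (Fin n → Fin n → Set) → (Fin n → ℕ) → ℕ → Fin n → Fin n → Set
  Reach K π p u w = InSub π p u × InSub π p w × Star (SubArc K π p) u w

  StronglyConnected : (Fin n → Fin n → Set) → (Fin n → ℕ) → ℕ → Fin n → Fin n → Set
  StronglyConnected K π p u w = Reach K π p u w × Reach K π p w u

  IsPotential : (Fin n → Fin n → Set) → (Fin n → ℕ) → ℕ → (Fin n → ℕ) → Set
  IsPotential K π p f =
    (∀ u → (f u ≡ 0 → p < π u) × (p < π u → f u ≡ 0)) ×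
    (∀ u w → Reach K π p u w → f w ≤ f u) ×
    (∀ u w → ((f u ≡ f w × 0 < f u) → StronglyConnected K π p u w) ×
             (StronglyConnected K π p u w → (f u ≡ f w × 0 < f u)))

module _ {A : Set} where

  IsOrderedTree : ℕ → (List A → Set) → Set
  IsOrderedTree h T =
    T [] ×
    (∀ xs ys → T (xs ++ ys) → T xs) ×
    (∀ xs → T xs → length xs ≤ h) ×
    (∀ xs → T xs → Σ (List A) λ ys → T (xs ++ ys) × length (xs ++ ys) ≡ h)

  -- L̄(T) = L(T) ∪ {⊤}; a leaf ξ = (ξ_{d-1}, ξ_{d-3}, …, ξ_1) is a vector of length h
  data Lbar (h : ℕ) (T : List A → Set) : Set where
    top  : Lbar h T
    leaf : (ξ : Vec A h) → T (toList ξ) → Lbar h T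

  module _ (_<A_ : A → A → Set) {h : ℕ} {T : List A → Set} where

    -- ξ|_p : keep the components ξ_q with q ≥ p (the first h ∸ ⌊p/2⌋ ones);
    -- nothing represents ⊤
    trunc : ℕ → Lbar h T → Maybe (List A)
    trunc p top        = nothing
    trunc p (leaf ξ _) = just (take (h ∸ ⌊ p /2⌋) (toList ξ))

    _≤T_ : Maybe (List A) → Maybe (List A) → Set
    _        ≤T nothing  = ⊤
    nothing  ≤T just _   = ⊥
    just xs  ≤T just ys  = Lex-≤ _≡_ _<A_ xs ys

    _<T_ : Maybe (List A) → Maybe (List A) → Set
    nothing  <T _        = ⊥
    just _   <T nothing  = ⊤
    just xs  <T just ys  = Lex-< _≡_ _<A_ xs ys

    _≤L_ : Lbar h T → Lbar h T → Set
    _          ≤L top        = ⊤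
    top        ≤L leaf _ _   = ⊥
    leaf ξ _   ≤L leaf ζ _   = Lex-≤ _≡_ _<A_ (toList ξ) (toList ζ)

    -- arc vw with ν(v) = x, ν(w) = y, π(v) = p is non-violated
    NonViolated : ℕ → Lbar h T → Lbar h T → Set
    NonViolated p x y =
      (IsEven p × trunc p y ≤T trunc p x) ⊎
      (IsOdd p × (trunc p y <T trunc p x ⊎ (x ≡ top × y ≡ top)))

    Tight : ℕ → Lbar h T → Lbar h T → Set
    Tight p x y = NonViolated p x y × (∀ z → NonViolated p z y → x ≤L z)

    -- lexicographic strict order on (Φ_d, ξ_{d-1}, Φ_{d-2}, …, Φ_2, ξ_1),
    -- stored as a vector of pairs (Φ_{2(h-j)}, ξ_{d-1-2j})
    lexLt : {m : ℕ} → Vec (ℕ × A) m → Vec (ℕ × A) m → Set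
    lexLt Vec.[] Vec.[] = ⊥
    lexLt ((a , x) Vec.∷ r) ((b , y) Vec.∷ s) =
      a < b ⊎ (a ≡ b × (x <A y ⊎ (x ≡ y × lexLt r s)))

    -- Φ^ν(v); nothing represents ∞
    PhiNu : {n : ℕ} → (ℕ → Fin n → ℕ) → Fin n → Lbar h T → Maybe (Vec (ℕ × A) h)
    PhiNu Φ v top        = nothing
    PhiNu Φ v (leaf ξ _) = just (tabulate λ j → (Φ (2 * (h ∸ toℕ j)) v , lookup ξ j))

    _<Φ_ : Maybe (Vec (ℕ × A) h) → Maybe (Vec (ℕ × A) h) → Set
    nothing <Φ _       = ⊥
    just _  <Φ nothing = ⊤
    just s  <Φ just t  = lexLt s t

module Submission where

-- For every level 2k ≥ π(v), either w lies in H_{2k}, so vw is an arc of H_{2k} and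
-- Φ_{2k}(w) ≤ Φ_{2k}(v), or π(w) > 2k and Φ_{2k}(w) = 0. Non-violation of vw says that the
-- labels satisfy ν(w)|_{π(v)} ≤ ν(v)|_{π(v)}, strictly if π(v) is odd. So on all components of
-- Φ^ν of priority above π(v), w is dominated by v: for odd π(v) this already contradicts
-- Φ^ν(v) < Φ^ν(w), and for even π(v) the first difference must be at Φ_{π(v)}, which forces
-- Φ_{π(v)}(v) = Φ_{π(v)}(w) > 0. Then v and w are strongly connected in H_{π(v)}, and a simple path
-- from w to v there closes with vw to a cycle whose maximal priority is π(v).

open import Defs
open import Data.Nat using (ℕ; zero; suc; _+_; _*_; _∸_; _⊔_; _%_; ⌊_/2⌋; _≤_; _<_; z≤n; s≤s; _≤?_)
open import Data.Nat.Properties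
  using (+-comm; *-suc; *-monoʳ-≤; *-cancelˡ-≤; n≤1+n; ≤-reflexive; ≤-trans; ≤-antisym; <-irrefl;
         <⇒≱; ≰⇒>; n≢0⇒n>0; m∸n≤m; m<n⇒0<n∸m; ∸-monoʳ-<; m∸[m∸n]≡n; m+n≤o⇒m≤o∸n; m≤o∸n⇒m+n≤o;
         ⊔-lub; m≤n⇒m≤n⊔o; m≤n⇒m≤o⊔n; module ≤-Reasoning)
open import Data.Nat.DivMod using (m<n⇒m%n≡m; n%n≡0)
open import Data.Fin as Fin using (Fin; toℕ; fromℕ; inject₁)
open import Data.Fin.Properties using (_≟_; toℕ-injective; toℕ-fromℕ<; toℕ-inject₁; toℕ-fromℕ; toℕ<n)
open import Data.Fin.Relation.Unary.Top using (view; ‵fromℕ; ‵inject₁)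
open import Data.List as List using (List; []; _∷_; length; take)
open import Data.List.Properties using (foldr-preservesᵇ; foldr-preservesᵒ)
open import Data.List.Relation.Unary.All as All using ()
open import Data.List.Relation.Unary.All.Properties as AllP using (¬Any⇒All¬)
open import Data.List.Relation.Unary.Any using (here; there; any?)
open import Data.List.Relation.Unary.Any.Properties as AnyP using ()
open import Data.List.Relation.Unary.AllPairs using ([]; _∷_)
open import Data.List.Relation.Unary.Unique.Propositional using (Unique)
open import Data.List.Membership.Propositional using (_∈_)
open import Data.List.Membership.Propositional.Properties using (∈-lookup)
open import Data.List.Relation.Binary.Lex.Core as Lex using (Lex; base; this)
open import Data.List.Relation.Binary.Lex.Strict using (Lex-<; Lex-≤)
open import Data.Vec as Vec using (Vec; tabulate; toList)
open import Data.Product using (Σ; ∃; _×_; _,_; proj₁; proj₂)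
open import Data.Sum using (_⊎_; inj₁; inj₂; [_,_])
open import Data.Empty using (⊥-elim)
open import Function using (_∘_; id)
open import Relation.Nullary using (¬_; yes; no; contradiction)
open import Relation.Binary.PropositionalEquality
  using (_≡_; _≢_; refl; sym; trans; cong; subst; subst₂; module ≡-Reasoning)
open import Relation.Binary.Structures using (IsStrictTotalOrder)
open import Relation.Binary.Construct.Closure.ReflexiveTransitive using (Star; ε; _◅_)

IsEven⇒≡2*⌊n/2⌋ : ∀ p → IsEven p → p ≡ 2 * ⌊ p /2⌋
IsEven⇒≡2*⌊n/2⌋ zero          _ = refl
IsEven⇒≡2*⌊n/2⌋ (suc (suc p)) e =
  trans (cong (suc ∘ suc) (IsEven⇒≡2*⌊n/2⌋ p e)) (sym (*-suc 2 ⌊ p /2⌋))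

IsOdd⇒≡1+2*⌊n/2⌋ : ∀ p → IsOdd p → p ≡ suc (2 * ⌊ p /2⌋)
IsOdd⇒≡1+2*⌊n/2⌋ (suc zero)    _ = refl
IsOdd⇒≡1+2*⌊n/2⌋ (suc (suc p)) o =
  trans (cong (suc ∘ suc) (IsOdd⇒≡1+2*⌊n/2⌋ p o)) (cong suc (sym (*-suc 2 ⌊ p /2⌋)))

2*⌊n/2⌋≤n : ∀ p → 2 * ⌊ p /2⌋ ≤ p
2*⌊n/2⌋≤n zero          = z≤n
2*⌊n/2⌋≤n (suc zero)    = z≤n
2*⌊n/2⌋≤n (suc (suc p)) = subst (_≤ suc (suc p)) (sym (*-suc 2 ⌊ p /2⌋)) (s≤s (s≤s (2*⌊n/2⌋≤n p)))

≤∸-swap : ∀ {m n o} → n ≤ o → m ≤ o ∸ n → n ≤ o ∸ m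
≤∸-swap {m} {n} {o} n≤o m≤o∸n =
  m+n≤o⇒m≤o∸n n (subst (_≤ o) (+-comm m n) (m≤o∸n⇒m+n≤o m n≤o m≤o∸n))

<∸-swap : ∀ {m n o} → n ≤ o → m < o ∸ n → n < o ∸ m
<∸-swap {m} {n} {o} n≤o m<o∸n =
  m+n≤o⇒m≤o∸n (suc n) (subst (_≤ o) (cong suc (+-comm m n)) (m≤o∸n⇒m+n≤o (suc m) n≤o m<o∸n))

module LexicographicPairs {A : Set} (_<A_ : A → A → Set)
                          (sto : IsStrictTotalOrder _≡_ _<A_) {h : ℕ} {T : List A → Set} where
  open IsStrictTotalOrder sto using (irrefl; asym)

  pairs : ∀ {k} → (Fin k → ℕ) → Vec A k → Vec (ℕ × A) k
  pairs a ξ = tabulate λ j → (a j , Vec.lookup ξ j)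

  Lex-tail : ∀ {P : Set} {R : Set} {x y : A} {xs ys : List A} →
             Lex P _≡_ _<A_ (y ∷ ys) (x ∷ xs) → x <A y ⊎ (x ≡ y × R) → Lex P _≡_ _<A_ ys xs × R
  Lex-tail (this y<x)       (inj₁ x<y)       = ⊥-elim (asym x<y y<x)
  Lex-tail (this y<x)       (inj₂ (x≡y , _)) = ⊥-elim (irrefl (sym x≡y) y<x)
  Lex-tail (Lex.next y≡x _) (inj₁ x<y)       = ⊥-elim (irrefl (sym y≡x) x<y)
  Lex-tail (Lex.next _ lex) (inj₂ (_ , r))   = lex , r

  ¬lexLt-dominated : ∀ {k} (a b : Fin k → ℕ) (ξ ζ : Vec A k) m →
    (∀ j → toℕ j < m → b j ≤ a j) →
    Lex-< _≡_ _<A_ (take m (toList ζ)) (take m (toList ξ)) →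
    ¬ lexLt _<A_ {h} {T} (pairs a ξ) (pairs b ζ)
  ¬lexLt-dominated a b Vec.[] Vec.[] m b≤a lex ()
  ¬lexLt-dominated a b (x Vec.∷ ξ) (y Vec.∷ ζ) zero b≤a (base ()) lt
  ¬lexLt-dominated a b (x Vec.∷ ξ) (y Vec.∷ ζ) (suc m) b≤a lex (inj₁ a<b) =
    <⇒≱ a<b (b≤a Fin.zero (s≤s z≤n))
  ¬lexLt-dominated a b (x Vec.∷ ξ) (y Vec.∷ ζ) (suc m) b≤a lex (inj₂ (_ , heads)) =
    let lex′ , lt = Lex-tail lex heads in
    ¬lexLt-dominated (a ∘ Fin.suc) (b ∘ Fin.suc) ξ ζ m (λ j j<m → b≤a (Fin.suc j) (s≤s j<m)) lex′ lt

  lexLt-dominated⇒tie : ∀ {k} (a b : Fin k → ℕ) (ξ ζ : Vec A k) m → m < k →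
    (∀ j → toℕ j ≤ m → b j ≤ a j) →
    Lex-≤ _≡_ _<A_ (take m (toList ζ)) (take m (toList ξ)) →
    lexLt _<A_ {h} {T} (pairs a ξ) (pairs b ζ) →
    Σ (Fin k) λ j → toℕ j ≡ m × a j ≡ b j
  lexLt-dominated⇒tie a b (x Vec.∷ ξ) (y Vec.∷ ζ) m m<k b≤a lex (inj₁ a<b) =
    ⊥-elim (<⇒≱ a<b (b≤a Fin.zero z≤n))
  lexLt-dominated⇒tie a b (x Vec.∷ ξ) (y Vec.∷ ζ) zero m<k b≤a lex (inj₂ (a≡b , _)) =
    Fin.zero , refl , a≡b
  lexLt-dominated⇒tie a b (x Vec.∷ ξ) (y Vec.∷ ζ) (suc m) (s≤s m<k) b≤a lex (inj₂ (_ , heads)) =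
    let lex′ , lt = Lex-tail lex heads
        j , j≡m , tie = lexLt-dominated⇒tie (a ∘ Fin.suc) (b ∘ Fin.suc) ξ ζ m m<k
                          (λ j j≤m → b≤a (Fin.suc j) (s≤s j≤m)) lex′ lt
    in Fin.suc j , cong suc j≡m , tie

lookup-injective : ∀ {A : Set} {xs : List A} → Unique xs →
                   ∀ i j → List.lookup xs i ≡ List.lookup xs j → i ≡ j
lookup-injective (_  ∷ _) Fin.zero    Fin.zero    _ = refl
lookup-injective (x≢ ∷ _) Fin.zero    (Fin.suc j) e = ⊥-elim (All.lookup x≢ (∈-lookup j) e)
lookup-injective (x≢ ∷ _) (Fin.suc i) Fin.zero    e = ⊥-elim (All.lookup x≢ (∈-lookup i) (sym e))
lookup-injective (_  ∷ u) (Fin.suc i) (Fin.suc j) e = cong Fin.suc (lookup-injective u i j e)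

module _ {n : ℕ} where

  data Walk (R : Fin n → Fin n → Set) : Fin n → Fin n → List (Fin n) → Set where
    []  : ∀ {x} → Walk R x x []
    _∷_ : ∀ {x y z ys} → R x y → Walk R y z ys → Walk R x z (y ∷ ys)

  walk-end : ∀ {R x z ys} → Walk R x z ys → List.lookup (x ∷ ys) (fromℕ (length ys)) ≡ z
  walk-end []      = refl
  walk-end (_ ∷ w) = walk-end w

  walk-arc : ∀ {R x z ys} → Walk R x z ys → ∀ (j : Fin (length ys)) →
             R (List.lookup (x ∷ ys) (inject₁ j)) (List.lookup (x ∷ ys) (Fin.suc j))
  walk-arc (r ∷ _) Fin.zero    = r
  walk-arc (_ ∷ w) (Fin.suc j) = walk-arc w j

  suffixFrom : ∀ {R x y z ys} → x ∈ (y ∷ ys) → Walk R y z ys → Unique (y ∷ ys) →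
               ∃ λ zs → Walk R x z zs × Unique (x ∷ zs)
  suffixFrom (here refl) w       u       = _ , w , u
  suffixFrom (there x∈)  (_ ∷ w) (_ ∷ u) = suffixFrom x∈ w u

  loopErase : ∀ {R x z} → Star R x z → ∃ λ ys → Walk R x z ys × Unique (x ∷ ys)
  loopErase ε = [] , [] , All.[] ∷ []
  loopErase {x = x} (_◅_ {j = y} r st) with loopErase st
  ... | ys , w , u with any? (x ≟_) (y ∷ ys)
  ...   | yes x∈ = suffixFrom x∈ w u
  ...   | no  x∉ = y ∷ ys , r ∷ w , ¬Any⇒All¬ _ x∉ ∷ u

  next-inject₁ : ∀ {k} (j : Fin k) → next {n} (inject₁ j) ≡ Fin.suc j
  next-inject₁ {k} j = toℕ-injective (trans (toℕ-fromℕ< _)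
    (trans (cong (λ m → suc m % suc k) (toℕ-inject₁ j)) (m<n⇒m%n≡m (s≤s (toℕ<n j)))))

  next-fromℕ : ∀ k → next {n} (fromℕ k) ≡ Fin.zero
  next-fromℕ k = toℕ-injective (trans (toℕ-fromℕ< _)
    (trans (cong (λ m → suc m % suc k) (toℕ-fromℕ k)) (n%n≡0 (suc k))))

  closeWalk : ∀ {R v w ys} → R v w → Walk R w v ys → Unique (w ∷ ys) →
              Σ (Cycle R) λ C → ArcOn C v w
  closeWalk {R} {w = w} {ys} r walk u =
    C , fromℕ (length ys) , walk-end walk , cong nodes (next-fromℕ _)
    where
    nodes = List.lookup (w ∷ ys)
    arc : ∀ i → R (nodes i) (nodes (next {n} i))
    arc i with view i
    ... | ‵fromℕ     = subst₂ R (sym (walk-end walk)) (cong nodes (sym (next-fromℕ _))) r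
    ... | ‵inject₁ j = subst (R (nodes (inject₁ j)) ∘ nodes) (sym (next-inject₁ j)) (walk-arc walk j)
    C : Cycle R
    C = record { len = length ys ; node = nodes ; simple = lookup-injective u ; arcs = arc }

  cycleThroughArc : ∀ {R v w} → R v w → Star R w v → Σ (Cycle R) λ C → ArcOn C v w
  cycleThroughArc r path = let _ , walk , u = loopErase path in closeWalk r walk u

  mapCycle : ∀ {R S : Fin n → Fin n → Set} → (∀ {x y} → R x y → S x y) → Cycle R → Cycle S
  mapCycle f C = record { len = len C ; node = node C ; simple = simple C ; arcs = f ∘ arcs C }

  maxPri-≡ : ∀ {R} (π : Fin n → ℕ) {p} (C : Cycle R) →
             (∀ i → π (node C i) ≤ p) → ∀ i → π (node C i) ≡ p → maxPri π C ≡ p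
  maxPri-≡ π {p} C bounded i attained = ≤-antisym
    (foldr-preservesᵇ {P = _≤ p} {f = _⊔_} ⊔-lub z≤n (AllP.map⁺ (AllP.tabulate⁺ bounded)))
    (foldr-preservesᵒ {P = p ≤_} {f = _⊔_} (λ x y → [ m≤n⇒m≤n⊔o y , m≤n⇒m≤o⊔n x ]) 0 _
      (inj₂ (AnyP.map⁺ (AnyP.tabulate⁺ {f = id} i (≤-reflexive (sym attained))))))

  -- The cycle is built in K_p, where every arc certifies priorities ≤ p, and then mapped into R.
  cycleOfPriority : ∀ {R} (π : Fin n → ℕ) {p v w} → R v w → π v ≡ p → Reach R π p w v →
                    Σ (Cycle R) λ C → ArcOn C v w × maxPri π C ≡ p
  cycleOfPriority π r πv≡p (πw≤p , _ , path) =
    let C , arcOn@(i , i↦v , _) = cycleThroughArc (r , ≤-reflexive πv≡p , πw≤p) path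
    in mapCycle proj₁ C , arcOn ,
       maxPri-≡ π C (λ i → proj₁ (proj₂ (arcs C i))) i (trans (cong π i↦v) πv≡p)

module _ {n : ℕ} {K : Fin n → Fin n → Set} {π : Fin n → ℕ} {p : ℕ} {f : Fin n → ℕ}
         (pot : IsPotential K π p f) where

  potential-antitone : ∀ {v w} → K v w → π v ≤ p → f w ≤ f v
  potential-antitone {v} {w} r πv≤p with π w ≤? p
  ... | yes πw≤p = proj₁ (proj₂ pot) v w (πv≤p , πw≤p , (r , πv≤p , πw≤p) ◅ ε)
  ... | no  πw≰p = subst (_≤ f v) (sym (proj₂ (proj₁ pot w) (≰⇒> πw≰p))) z≤n

  potential-tie⇒reach : ∀ {v w} → π v ≡ p → f v ≡ f w → Reach K π p w v
  potential-tie⇒reach {v} {w} πv≡p tie =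
    proj₂ (proj₁ (proj₂ (proj₂ pot) v w) (tie , n≢0⇒n>0 fv≢0))
    where
    fv≢0 : f v ≢ 0
    fv≢0 fv≡0 = <-irrefl (sym πv≡p) (proj₁ (proj₁ pot v) fv≡0)

module IncreasingArc {n : ℕ} {K : Fin n → Fin n → Set} {π : Fin n → ℕ} {h : ℕ}
         (priority-bounds : ∀ v → 1 ≤ π v × π v ≤ 2 * h)
         {A : Set} (_<A_ : A → A → Set) (sto : IsStrictTotalOrder _≡_ _<A_) {T : List A → Set}
         (Φ : ℕ → Fin n → ℕ)
         (pot : ∀ k → 1 ≤ k → k ≤ h → IsPotential K π (2 * k) (Φ (2 * k))) where
  open LexicographicPairs _<A_ sto {h} {T}

  ⌊π/2⌋≤h : ∀ v → ⌊ π v /2⌋ ≤ h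
  ⌊π/2⌋≤h v = *-cancelˡ-≤ 2 (≤-trans (2*⌊n/2⌋≤n (π v)) (proj₂ (priority-bounds v)))

  1≤⌊π/2⌋ : ∀ v → IsEven (π v) → 1 ≤ ⌊ π v /2⌋
  1≤⌊π/2⌋ v π-even = n≢0⇒n>0 λ c≡0 → contradiction
    (subst (1 ≤_) (trans (IsEven⇒≡2*⌊n/2⌋ (π v) π-even) (cong (2 *_) c≡0)) (proj₁ (priority-bounds v)))
    λ ()

  potential-at-even : ∀ v → IsEven (π v) → IsPotential K π (π v) (Φ (π v))
  potential-at-even v π-even =
    subst (λ q → IsPotential K π q (Φ q)) (sym (IsEven⇒≡2*⌊n/2⌋ (π v) π-even))
      (pot ⌊ π v /2⌋ (1≤⌊π/2⌋ v π-even) (⌊π/2⌋≤h v))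

  potentials : Fin n → Fin h → ℕ
  potentials v j = Φ (2 * (h ∸ toℕ j)) v

  potentials-antitone : ∀ {v w} → K v w →
                        ∀ j → π v ≤ 2 * (h ∸ toℕ j) → potentials w j ≤ potentials v j
  potentials-antitone r j =
    potential-antitone (pot (h ∸ toℕ j) (m<n⇒0<n∸m (toℕ<n j)) (m∸n≤m h (toℕ j))) r

  ¬increasing-odd : ∀ {v w} → K v w → IsOdd (π v) → (ξ ζ : Vec A h) →
    Lex-< _≡_ _<A_ (take (h ∸ ⌊ π v /2⌋) (toList ζ)) (take (h ∸ ⌊ π v /2⌋) (toList ξ)) →
    ¬ lexLt _<A_ {h} {T} (pairs (potentials v) ξ) (pairs (potentials w) ζ)
  ¬increasing-odd {v} r π-odd ξ ζ = ¬lexLt-dominated _ _ ξ ζ (h ∸ c) dominated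
    where
    c = ⌊ π v /2⌋
    πv≡1+2c = IsOdd⇒≡1+2*⌊n/2⌋ (π v) π-odd
    c≤h = ⌊π/2⌋≤h v
    dominated : ∀ j → toℕ j < h ∸ c → potentials _ j ≤ potentials v j
    dominated j j<h∸c = potentials-antitone r j (begin
      π v                ≡⟨ πv≡1+2c ⟩
      suc (2 * c)        ≤⟨ n≤1+n _ ⟩
      2 + 2 * c          ≡⟨ *-suc 2 c ⟨
      2 * suc c          ≤⟨ *-monoʳ-≤ 2 (<∸-swap c≤h j<h∸c) ⟩
      2 * (h ∸ toℕ j)    ∎)
      where open ≤-Reasoning

  increasing-even⇒tie : ∀ {v w} → K v w → IsEven (π v) → (ξ ζ : Vec A h) →
    Lex-≤ _≡_ _<A_ (take (h ∸ ⌊ π v /2⌋) (toList ζ)) (take (h ∸ ⌊ π v /2⌋) (toList ξ)) →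
    lexLt _<A_ {h} {T} (pairs (potentials v) ξ) (pairs (potentials w) ζ) →
    Φ (π v) v ≡ Φ (π v) w
  increasing-even⇒tie {v} {w} r π-even ξ ζ lex lt =
    let j , j≡h∸c , tie = lexLt-dominated⇒tie _ _ ξ ζ (h ∸ c) h∸c<h dominated lex lt
    in subst (λ q → Φ q v ≡ Φ q w) (level j≡h∸c) tie
    where
    c = ⌊ π v /2⌋
    πv≡2c = IsEven⇒≡2*⌊n/2⌋ (π v) π-even
    c≤h = ⌊π/2⌋≤h v
    h∸c<h : h ∸ c < h
    h∸c<h = ∸-monoʳ-< (1≤⌊π/2⌋ v π-even) c≤h
    dominated : ∀ j → toℕ j ≤ h ∸ c → potentials w j ≤ potentials v j
    dominated j j≤h∸c = potentials-antitone r j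
      (subst (_≤ 2 * (h ∸ toℕ j)) (sym πv≡2c) (*-monoʳ-≤ 2 (≤∸-swap c≤h j≤h∸c)))
    level : ∀ {j : Fin h} → toℕ j ≡ h ∸ c → 2 * (h ∸ toℕ j) ≡ π v
    level {j} j≡h∸c = begin
      2 * (h ∸ toℕ j)        ≡⟨ cong (λ m → 2 * (h ∸ m)) j≡h∸c ⟩
      2 * (h ∸ (h ∸ c))      ≡⟨ cong (2 *_) (m∸[m∸n]≡n c≤h) ⟩
      2 * c                  ≡⟨ sym πv≡2c ⟩
      π v                    ∎
      where open ≡-Reasoning

  evenCycleThrough : ∀ {v w} → K v w → (x y : Lbar h T) → NonViolated _<A_ (π v) x y →
    _<Φ_ _<A_ {h} {T} (PhiNu _<A_ Φ v x) (PhiNu _<A_ Φ w y) →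
    Σ (Cycle K) λ C → IsEven (maxPri π C) × ArcOn C v w × maxPri π C ≡ π v
  evenCycleThrough r top         _          _                            ()
  evenCycleThrough r (leaf _ _)  top        (inj₁ (_ , ()))              _
  evenCycleThrough r (leaf _ _)  top        (inj₂ (_ , inj₁ ()))         _
  evenCycleThrough r (leaf _ _)  _          (inj₂ (_ , inj₂ (() , _)))   _
  evenCycleThrough r (leaf ξ _)  (leaf ζ _) (inj₂ (π-odd , inj₁ lex))    lt =
    ⊥-elim (¬increasing-odd r π-odd ξ ζ lex lt)
  evenCycleThrough {v} r (leaf ξ _) (leaf ζ _) (inj₁ (π-even , lex)) lt =
    let tie = increasing-even⇒tie r π-even ξ ζ lex lt
        w↝v = potential-tie⇒reach (potential-at-even v π-even) refl tie
        C , arcOn , maxPri≡πv = cycleOfPriority π r refl w↝v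
    in C , subst IsEven (sym maxPri≡πv) π-even , arcOn , maxPri≡πv

lemma5p2 : {n : ℕ} (E : Fin n → Fin n → Set) (owner : Fin n → Player)
    (h : ℕ) (π : Fin n → ℕ) →
    (∀ v → ∃ λ w → E v w) →
    (∀ v → 1 ≤ π v × π v ≤ 2 * h) →
    (τ : Fin n → Fin n) → (∀ v → owner v ≡ odd → E v (τ v)) →
    {A : Set} (_<A_ : A → A → Set) → IsStrictTotalOrder _≡_ _<A_ →
    (T : List A → Set) → IsOrderedTree h T →
    (Φ : ℕ → Fin n → ℕ) →
    (∀ k → 1 ≤ k → k ≤ h → IsPotential (Hgraph E owner τ π) π (2 * k) (Φ (2 * k))) →
    (ν : Fin n → Lbar h T) → (v w : Fin n) →
    Hgraph E owner τ π v w →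
    Tight _<A_ (π v) (ν v) (ν w) →
    _<Φ_ _<A_ {h} {T} (PhiNu _<A_ Φ v (ν v)) (PhiNu _<A_ Φ w (ν w)) →
    Σ (Cycle (Hgraph E owner τ π)) λ C →
      IsEven (maxPri π C) × ArcOn C v w × maxPri π C ≡ π v
lemma5p2 E owner h π _ priority-bounds τ _ _<A_ sto T _ Φ pot ν v w vw (nonViolated , _) =
  IncreasingArc.evenCycleThrough priority-bounds _<A_ sto {T} Φ pot vw (ν v) (ν w) nonViolated
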